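{- Let $H$ be a colored graph that has a guarded cutvertex decomposition $(T,\beta,g)$ with guard size at most $c$. Then $H$ has no matching $x_1y_1,\dots,x_{c+1}y_{c+1}$ such that every $x_i$ lies in a color class $C_x$ and every $y_i$ lies in a color class $C_y$ (where possibly $C_x=C_y$).
   Context: A colored graph is a finite simple graph with a (not necessarily proper) vertex coloring. $H^{\bullet}$ is obtained from $H$ by making every color class a clique. For a rooted tree decomposition $(T,\beta)$, $\sigma(t)=\beta(t)\cap\beta(\text{parent}(t))$ and $\sigma(\text{root})=\emptyset$. A guarded cutvertex decomposition of $H$ is $(T,\beta,g)$ with $(T,\beta)$ a rooted tree decomposition of $H^{\bullet}$ and $\sigma(t)\subseteq g(t)\subseteq\beta(t)$, such that $g(t)$ is a vertex cover of $H[\beta(t)]$ for all $t$ and $|\sigma(t')\setminus g(t)|\le1$ for every child $t'$ of $t$. Its guard size is $\max_t|g(t)|$. -}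

module Defs where

open import Data.Nat using (ℕ; zero; suc; _≤_)
open import Data.Bool using (Bool; T)
open import Data.Fin using (Fin; zero; suc; toℕ)
open import Data.Fin.Subset using (Subset; _∈_; _∉_; _⊆_; _∩_; _─_; ∣_∣; ⊥)
open import Data.Product using (Σ; ∃; _×_; _,_)
open import Data.Sum using (_⊎_)
open import Relation.Binary.PropositionalEquality using (_≡_; _≢_)
open import Relation.Nullary using (¬_)

record ColoredGraph (n : ℕ) : Set where
  field
    adj    : Fin n → Fin n → Bool
    adj-sym   : ∀ u v → T (adj u v) → T (adj v u)
    adj-irrefl : ∀ u → ¬ T (adj u u)
    col    : Fin n → ℕ

module _ {n : ℕ} (H : ColoredGraph n) where
  open ColoredGraph H

  Edge : Fin n → Fin n → Set
  Edge u v = T (adj u v)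

  Edge• : Fin n → Fin n → Set
  Edge• u v = Edge u v ⊎ (u ≢ v × col u ≡ col v)

-- A rooted tree on m+1 nodes is given by nodes Fin (suc m),
-- root = zero, and a parent for every non-root node (suc i), whose index is
-- strictly smaller (every rooted tree admits such a numbering, e.g. BFS
-- order; this guarantees acyclicity and connectedness).

record RootedTree : Set where
  field
    m        : ℕ
    parent   : Fin m → Fin (suc m)
    parent<  : ∀ i → toℕ (parent i) ≤ toℕ i   -- i.e. parent(suc i) < suc i

  Node : Set
  Node = Fin (suc m)

  root : Node
  root = zero

  TEdge : Node → Node → Set
  TEdge s t = (∃ λ i → s ≡ suc i × t ≡ parent i) ⊎ (∃ λ i → t ≡ suc i × s ≡ parent i)

  data WalkIn (P : Node → Set) : Node → Node → Set where
    here : ∀ {t} → P t → WalkIn P t t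
    step : ∀ {s t u} → P s → TEdge s t → WalkIn P t u → WalkIn P s u

  ConnectedIn : (Node → Set) → Set
  ConnectedIn P = ∀ s t → P s → P t → WalkIn P s t

record TreeDecomposition {n : ℕ} (E : Fin n → Fin n → Set) (T : RootedTree) : Set where
  open RootedTree T
  field
    β         : Node → Subset n
    covers-vertices : ∀ v → ∃ λ t → v ∈ β t
    covers-edges    : ∀ u v → E u v → ∃ λ t → (u ∈ β t × v ∈ β t)
    connected       : ∀ v → ConnectedIn (λ t → v ∈ β t)

  σ : Node → Subset n
  σ zero    = ⊥
  σ (suc i) = β (suc i) ∩ β (parent i)

record GuardedCutvertexDecomposition {n : ℕ} (H : ColoredGraph n) : Set where
  field
    tree : RootedTree
    td   : TreeDecomposition (Edge• H) tree
  open RootedTree tree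
  open TreeDecomposition td
  field
    g       : Node → Subset n
    σ⊆g     : ∀ t → σ t ⊆ g t
    g⊆β     : ∀ t → g t ⊆ β t
    vcover  : ∀ t u v → u ∈ β t → v ∈ β t → Edge H u v → u ∈ g t ⊎ v ∈ g t
    child≤1 : ∀ i → ∣ σ (suc i) ─ g (parent i) ∣ ≤ 1

  guardSizeAtMost : ℕ → Set
  guardSizeAtMost c = ∀ t → ∣ g t ∣ ≤ c

record ColorMatching {n : ℕ} (H : ColoredGraph n) (k : ℕ) : Set where
  open ColoredGraph H
  field
    x y   : Fin k → Fin n
    edge  : ∀ i → Edge H (x i) (y i)
    x-inj : ∀ i j → x i ≡ x j → i ≡ j
    y-inj : ∀ i j → y i ≡ y j → i ≡ j
    x≢y   : ∀ i j → x i ≢ y j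
    a b   : ℕ
    x-col : ∀ i → col (x i) ≡ a
    y-col : ∀ i → col (y i) ≡ b

module Submission where

-- Let x₁y₁,…,x_{c+1}y_{c+1} be a matching with all xᵢ of colour a
-- and all yᵢ of colour b.  Each colour class is a clique of H•, so by the Helly
-- property of subtrees of a tree it lies inside a single bag: the xᵢ lie in a
-- bag β(t_x) and the yᵢ in a bag β(t_y).  If t_x = t_y, the guard g(t_x) is a
-- vertex cover of H[β(t_x)] and hence contains an endpoint of every xᵢyᵢ.
-- Otherwise one of the two nodes, say t_x, does not lie below the other; every
-- edge xᵢyᵢ sits in some bag, and the subtree of bags containing xᵢ or yᵢ must
-- then cross the tree edge from t_x to its parent, which puts xᵢ or yᵢ into the
-- adhesion σ(t_x) ⊆ g(t_x).  Either way one guard g(t) meets all c+1 disjoint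
-- edges, so |g(t)| ≥ c+1, contradicting the guard size bound.

open import Defs
open import Data.Nat using (ℕ; suc)
open import Relation.Nullary using (¬_)

open import Data.Nat using (zero; _≤_; _<_; z≤n; s≤s; _≤?_)
open import Data.Nat.Properties
  using (≤-refl; ≤-trans; ≤-antisym; <⇒≤; ≰⇒>; <-≤-trans; n≤1+n; 1+n≰n)
open import Data.Fin using (Fin; zero; suc; toℕ) renaming (_≟_ to _≟F_)
open import Data.Fin.Properties using (toℕ-injective; suc-injective)
open import Data.Fin.Subset using (Subset; _∈_; _-_; ∣_∣)
open import Data.Fin.Subset.Properties
  using (_∈?_; ∉⊥; x∈p∩q⁺; x∈p∩q⁻; x∈p∧x∉q⇒x∈p─q; x≢y⇒x∉⁅y⁆; x∈p⇒∣p-x∣<∣p∣)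
open import Data.Product using (Σ; ∃; _×_; _,_; proj₁; proj₂)
open import Data.Sum using (_⊎_; inj₁; inj₂; swap)
open import Data.Empty using (⊥-elim)
open import Relation.Nullary using (Dec; yes; no)
open import Relation.Binary.PropositionalEquality
  using (_≡_; _≢_; refl; sym; trans; subst)

injection-into-subset : ∀ {n} k (S : Subset n) (f : Fin k → Fin n)
  → (∀ i j → f i ≡ f j → i ≡ j) → (∀ i → f i ∈ S) → k ≤ ∣ S ∣
injection-into-subset zero    S f inj f∈S = z≤n
injection-into-subset (suc k) S f inj f∈S =
  <-≤-trans (s≤s (injection-into-subset k (S - f zero) (λ i → f (suc i)) inj′ rest∈))
            (x∈p⇒∣p-x∣<∣p∣ (f∈S zero))
  where
    inj′ : ∀ i j → f (suc i) ≡ f (suc j) → i ≡ j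
    inj′ i j e = suc-injective (inj (suc i) (suc j) e)

    rest∈ : ∀ i → f (suc i) ∈ S - f zero
    rest∈ i = x∈p∧x∉q⇒x∈p─q (f∈S (suc i)) (x≢y⇒x∉⁅y⁆ λ e → suc≢zero (inj (suc i) zero e))
      where
        suc≢zero : Fin.suc i ≢ zero
        suc≢zero ()

least-witness : ∀ {n} (P : Fin n → Set) → (∀ t → Dec (P t)) → ∀ t → P t
  → ∃ λ t₀ → P t₀ × (∀ t → P t → toℕ t₀ ≤ toℕ t)
least-witness {suc n} P P? t pt with P? zero
... | yes p₀ = zero , p₀ , λ _ _ → z≤n
least-witness {suc n} P P? zero    pt | no ¬p₀ = ⊥-elim (¬p₀ pt)
least-witness {suc n} P P? (suc t) pt | no ¬p₀
  with t₀ , pt₀ , least ← least-witness (λ i → P (suc i)) (λ i → P? (suc i)) t pt =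
  suc t₀ , pt₀ , λ { zero p → ⊥-elim (¬p₀ p) ; (suc t′) p → s≤s (least t′ p) }

argmax : ∀ {k} (f : Fin (suc k) → ℕ) → ∃ λ j → ∀ i → f i ≤ f j
argmax {zero}  f = zero , λ { zero → ≤-refl }
argmax {suc k} f with j , max ← argmax (λ i → f (suc i)) | f zero ≤? f (suc j)
... | yes f₀≤ = suc j , λ { zero → f₀≤ ; (suc i) → max i }
... | no  f₀≰ = zero  , λ { zero → ≤-refl ; (suc i) → ≤-trans (max i) (<⇒≤ (≰⇒> f₀≰)) }

module SubtreeFacts (T : RootedTree) where
  open RootedTree T

  data Under (s : Node) : Node → Set where
    self  : Under s s
    child : ∀ {i} → Under s (parent i) → Under s (suc i)

  -- Parents have smaller indices, so descendants have larger ones.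
  under-index : ∀ {s t} → Under s t → toℕ s ≤ toℕ t
  under-index self          = ≤-refl
  under-index (child {i} u) = ≤-trans (under-index u) (≤-trans (parent< i) (n≤1+n _))

  under-antisym : ∀ {s t} → Under s t → Under t s → s ≡ t
  under-antisym u v = toℕ-injective (≤-antisym (under-index u) (under-index v))

  under? : ∀ s t → Dec (Under s t)
  under? s t = search (suc (toℕ t)) t ≤-refl
    where
      search : ∀ fuel t → toℕ t < fuel → Dec (Under s t)
      search (suc fuel) t t<fuel with s ≟F t
      ... | yes refl = yes self
      search (suc fuel) zero    _         | no s≢t = no λ { self → s≢t refl }
      search (suc fuel) (suc i) (s≤s i<) | no s≢t
        with search fuel (parent i) (<-≤-trans (s≤s (parent< i)) i<)
      ... | yes u = yes (child u)
      ... | no ¬u = no λ { self → s≢t refl ; (child u) → ¬u u }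

  walk-start : ∀ {P a b} → WalkIn P a b → P a
  walk-start (here p)     = p
  walk-start (step p _ _) = p

  -- A walk that starts inside the subtree of s and ends outside it must use
  -- the edge from s to its parent; so s is not the root, and both s and its
  -- parent lie on the walk.
  leaving-subtree : ∀ {P s a b} → WalkIn P a b → Under s a → ¬ Under s b
    → Σ (Fin m) λ k → s ≡ suc k × P s × P (parent k)
  leaving-subtree (here p) u ¬u = ⊥-elim (¬u u)
  leaving-subtree (step _ (inj₂ (i , refl , refl)) w) u ¬u = leaving-subtree w (child u) ¬u
  leaving-subtree {s = s} (step p (inj₁ (i , refl , refl)) w) u ¬u with s ≟F suc i | u
  ... | yes refl | _        = i , refl , p , walk-start w
  ... | no s≢a   | self     = ⊥-elim (s≢a refl)
  ... | no s≢a   | child u′ = leaving-subtree w u′ ¬u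

module DecompositionFacts {n : ℕ} {E : Fin n → Fin n → Set} {T : RootedTree}
                          (D : TreeDecomposition E T) where
  open RootedTree T
  open TreeDecomposition D
  open SubtreeFacts T

  crossing⇒adhesion : ∀ {v s a b} → v ∈ β a → Under s a → v ∈ β b → ¬ Under s b → v ∈ σ s
  crossing⇒adhesion {v} {a = a} {b} va u vb ¬u
    with k , refl , vs , vp ← leaving-subtree (connected v a b va vb) u ¬u = x∈p∩q⁺ (vs , vp)

  σ⊆β : ∀ t {v} → v ∈ σ t → v ∈ β t
  σ⊆β zero    v∈σ = ⊥-elim (∉⊥ v∈σ)
  σ⊆β (suc i) v∈σ = proj₁ (x∈p∩q⁻ (β (suc i)) (β (parent i)) v∈σ)

  separation : ∀ {p q s u v w} → p ∈ β u → Under s u → q ∈ β v → ¬ Under s v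
    → p ∈ β w → q ∈ β w → p ∈ σ s ⊎ q ∈ σ s
  separation {s = s} {w = w} pu u qv ¬v pw qw with under? s w
  ... | yes w-under = inj₂ (crossing⇒adhesion qw w-under qv ¬v)
  ... | no ¬w-under = inj₁ (crossing⇒adhesion pu u pw ¬w-under)

  top-bag : ∀ v → ∃ λ t₀ → v ∈ β t₀ × (∀ t → v ∈ β t → toℕ t₀ ≤ toℕ t)
  top-bag v = least-witness (λ t → v ∈ β t) (λ t → v ∈? β t)
                            (proj₁ (covers-vertices v)) (proj₂ (covers-vertices v))

  top : Fin n → Node
  top v = proj₁ (top-bag v)

  top-contains : ∀ v → v ∈ β (top v)
  top-contains v = proj₁ (proj₂ (top-bag v))

  top-least : ∀ v t → v ∈ β t → toℕ (top v) ≤ toℕ t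
  top-least v = proj₂ (proj₂ (top-bag v))

  -- Every bag containing v lies below the top bag of v: otherwise v would be
  -- in σ(top v), hence also in the bag of the parent, which has smaller index.
  under-top : ∀ v s → v ∈ β s → Under (top v) s
  under-top v s vs with under? (top v) s
  ... | yes u = u
  ... | no ¬u = ⊥-elim (parent-not-smaller (top v) refl
                          (crossing⇒adhesion (top-contains v) self vs ¬u))
    where
      parent-not-smaller : ∀ t → t ≡ top v → ¬ v ∈ σ t
      parent-not-smaller zero    _ v∈σ = ∉⊥ v∈σ
      parent-not-smaller (suc i) t≡top v∈σ =
        1+n≰n (≤-trans (subst (λ t → toℕ t ≤ toℕ (parent i)) (sym t≡top)
                          (top-least v (parent i) (proj₂ (x∈p∩q⁻ (β (suc i)) (β (parent i)) v∈σ))))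
                       (parent< i))

  -- Helly property for cliques: a nonempty family of pairwise E-adjacent
  -- vertices lies in a common bag, namely the deepest of their top bags.
  clique-in-bag : ∀ {k} (z : Fin (suc k) → Fin n)
    → (∀ i j → z i ≢ z j → E (z i) (z j)) → ∃ λ t → ∀ i → z i ∈ β t
  clique-in-bag {k} z adjacent = top (z j) , in-top-j
    where
      deepest : ∃ λ j → ∀ i → toℕ (top (z i)) ≤ toℕ (top (z j))
      deepest = argmax (λ i → toℕ (top (z i)))

      j : Fin (suc k)
      j = proj₁ deepest

      in-top-j : ∀ i → z i ∈ β (top (z j))
      in-top-j i with z i ≟F z j
      ... | yes zi≡zj = subst (λ v → v ∈ β (top (z j))) (sym zi≡zj) (top-contains (z j))
      ... | no  zi≢zj with under? (top (z j)) (top (z i))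
      ...   | yes u = subst (λ t → z i ∈ β t)
                            (toℕ-injective (≤-antisym (proj₂ deepest i) (under-index u)))
                            (top-contains (z i))
      ...   | no ¬u =
        let (w , ziw , zjw) = covers-edges (z i) (z j) (adjacent i j zi≢zj)
        in σ⊆β (top (z j)) (crossing⇒adhesion ziw (under-top (z j) w zjw) (top-contains (z i)) ¬u)

module GuardFacts {n : ℕ} (H : ColoredGraph n) (D : GuardedCutvertexDecomposition H) where
  open ColoredGraph H
  open GuardedCutvertexDecomposition D
  open RootedTree tree
  open TreeDecomposition td
  open SubtreeFacts tree
  open DecompositionFacts td

  colour-class-in-bag : ∀ {k} (z : Fin (suc k) → Fin n) (a : ℕ)
    → (∀ i → col (z i) ≡ a) → ∃ λ t → ∀ i → z i ∈ β t
  colour-class-in-bag z a z-col =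
    clique-in-bag z λ i j zi≢zj → inj₂ (zi≢zj , trans (z-col i) (sym (z-col j)))

  guard-separates : ∀ {k} (x y : Fin k → Fin n) (s t : Node)
    → (∀ i → ∃ λ w → x i ∈ β w × y i ∈ β w)
    → (∀ i → x i ∈ β s) → (∀ i → y i ∈ β t) → ¬ Under s t
    → ∀ i → x i ∈ g s ⊎ y i ∈ g s
  guard-separates x y s t shared xs yt ¬u i
    with w , xw , yw ← shared i
    with separation (xs i) self (yt i) ¬u xw yw
  ... | inj₁ x∈σ = inj₁ (σ⊆g s x∈σ)
  ... | inj₂ y∈σ = inj₂ (σ⊆g s y∈σ)

  -- Some single guard meets every edge xᵢyᵢ whose endpoints lie in bags β(t_x)
  -- and β(t_y) respectively: g(t) for t = t_x = t_y by the vertex cover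
  -- property, otherwise the guard of whichever of t_x, t_y is not below the other.
  guard-meets-edges : ∀ {k} (x y : Fin k → Fin n) → (∀ i → Edge H (x i) (y i))
    → (tx ty : Node) → (∀ i → x i ∈ β tx) → (∀ i → y i ∈ β ty)
    → ∃ λ t → ∀ i → x i ∈ g t ⊎ y i ∈ g t
  guard-meets-edges x y edge tx ty x∈tx y∈ty with under? tx ty | under? ty tx
  ... | no ¬u | _     = tx , guard-separates x y tx ty shared x∈tx y∈ty ¬u
    where
      shared : ∀ i → ∃ λ w → x i ∈ β w × y i ∈ β w
      shared i = covers-edges (x i) (y i) (inj₁ (edge i))
  ... | yes _ | no ¬u = ty , λ i → swap (guard-separates y x ty tx shared y∈ty x∈tx ¬u i)
    where
      shared : ∀ i → ∃ λ w → y i ∈ β w × x i ∈ β w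
      shared i with w , xw , yw ← covers-edges (x i) (y i) (inj₁ (edge i)) = w , yw , xw
  ... | yes u | yes u′ with refl ← under-antisym u u′ =
    tx , λ i → vcover tx (x i) (y i) (x∈tx i) (y∈ty i) (edge i)

  guard-meets-matching : ∀ {k} (M : ColorMatching H (suc k))
    → ∃ λ t → ∀ i → ColorMatching.x M i ∈ g t ⊎ ColorMatching.y M i ∈ g t
  guard-meets-matching M =
    guard-meets-edges x y edge (proj₁ x-bag) (proj₁ y-bag) (proj₂ x-bag) (proj₂ y-bag)
    where
      open ColorMatching M
      x-bag = colour-class-in-bag x a x-col
      y-bag = colour-class-in-bag y b y-col

-- A set meeting every edge of a matching of size k has at least k elements:
-- choosing the met endpoint of each edge is injective since the 2k endpoints
-- are distinct.
matching-transversal : ∀ {n k} (H : ColoredGraph n) (M : ColorMatching H k) (S : Subset n)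
  → (∀ i → ColorMatching.x M i ∈ S ⊎ ColorMatching.y M i ∈ S) → k ≤ ∣ S ∣
matching-transversal {n} {k} H M S meets = injection-into-subset k S endpoint endpoint-inj endpoint∈
  where
    open ColorMatching M

    endpoint : Fin k → Fin n
    endpoint i with meets i
    ... | inj₁ _ = x i
    ... | inj₂ _ = y i

    endpoint-inj : ∀ i j → endpoint i ≡ endpoint j → i ≡ j
    endpoint-inj i j e with meets i | meets j
    ... | inj₁ _ | inj₁ _ = x-inj i j e
    ... | inj₂ _ | inj₂ _ = y-inj i j e
    ... | inj₁ _ | inj₂ _ = ⊥-elim (x≢y i j e)
    ... | inj₂ _ | inj₁ _ = ⊥-elim (x≢y j i (sym e))

    endpoint∈ : ∀ i → endpoint i ∈ S
    endpoint∈ i with meets i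
    ... | inj₁ x∈S = x∈S
    ... | inj₂ y∈S = y∈S

lemma6p7 : ∀ {n : ℕ} (H : ColoredGraph n) (c : ℕ)
    → (D : GuardedCutvertexDecomposition H)
    → GuardedCutvertexDecomposition.guardSizeAtMost D c
    → ¬ ColorMatching H (suc c)
lemma6p7 H c D guard-size M
  with t , meets ← GuardFacts.guard-meets-matching H D M =
  1+n≰n (≤-trans (matching-transversal H M (g t) meets) (guard-size t))
  where open GuardedCutvertexDecomposition D
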